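{- Consider the following urn process. Start with an even number $n$ of white balls in an urn. In each round, as long as there is at least one white ball in the urn, remove one ball from the urn chosen uniformly at random, and then, if the removed ball was white, replace one remaining white ball by a black ball. Let $T$ be the number of rounds until there are no white balls left. Let $\alpha(n)$ be a positive integer smaller than $n$. Then $$\Pr\left(T<n-\alpha(n)\right)<\frac{n^3}{(\alpha(n))^4}.$$ -}

module Defs where

open import Data.Nat using (ℕ; zero; suc; _+_; _∸_; _^_; _<_; NonZero; >-nonZero)
open import Data.Nat.Properties using (m^n≢0)
open import Data.Integer using (+_)
open import Data.Rational using (ℚ; _/_; _*_; 0ℚ; 1ℚ)
import Data.Rational as ℚ

-- Urn state: w white balls, b black balls.
-- One round (only when w ≥ 1): a ball is removed uniformly at random.
--   * with probability w/(w+b) it is white; then one remaining white ball is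
--     replaced by a black one:      (w , b) ↦ (w ∸ 2 , b + 1)
--   * with probability b/(w+b) it is black:   (w , b) ↦ (w , b ∸ 1)
-- T = number of rounds until no white ball is left.
--
-- probTLess w b m = Pr(T < m) for the process started at (w , b),
-- computed exactly by first-step analysis.
probTLess : ℕ → ℕ → ℕ → ℚ
probTLess w       b zero    = 0ℚ
probTLess zero    b (suc m) = 1ℚ
probTLess (suc w) b (suc m) =
    ((+ suc w) / (suc w + b)) * probTLess (suc w ∸ 2) (suc b) m
  ℚ.+ ((+ b) / (suc w + b)) * probTLess (suc w) (b ∸ 1) m

bound : (n α : ℕ) → 0 < α → ℚ
bound n α α>0 = (+ (n ^ 3)) / (α ^ 4)
  where
  instance
    nzα : NonZero α
    nzα = >-nonZero α>0
    nz : NonZero (α ^ 4)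
    nz = m^n≢0 α 4

-- Fix r = α + 1 and, for a state with s balls, put
-- x_s = 1 − r(r−1)/(s(s−1)).  By induction on the number m = s − r of remaining rounds, a state
-- with 2p white and b black balls (2p + b = s) satisfies Pr(T ≤ m) ≤ x_s^p: the first round leads
-- to states bounded by x_{s−1}^(p−1) and x_{s−1}^p with weights 2p/s and b/s, so
-- Pr(T ≤ m) ≤ x^(p−1) (x + p d) for x = x_{s−1} and d = (2/s)(1 − x), and Bernoulli's inequality
-- x^(p−1) (x + p d) ≤ (x + d)^p closes the induction because x + d = x_s.
-- Starting from n white balls, T < n − α means T ≤ n − r, so the probability is at most
-- (Y/D)^k with k = n/2, D = n(n−1), E = α(α+1) and Y = D − E.  Bernoulli again gives
-- Y^(k−1) (Y + kE) ≤ D^k, while AM–GM gives 4α²Y ≤ (α² + Y)² ≤ n⁴, hence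
-- α⁴Y ≤ α²n⁴/4 < n³kE since n = 2k and α² ≤ E.  Multiplying, Y^k α⁴ < n³ D^k.
module Submission where

open import Relation.Binary.PropositionalEquality

module Rational where

  open import Data.Nat as ℕ using (zero; suc; NonZero)
  import Data.Nat.Properties as ℕ
  open import Data.Nat.Solver using (module +-*-Solver)
  open import Data.Integer as ℤ using (+_)
  import Data.Integer.Properties as ℤ
  open import Data.Rational as ℚ using (0ℚ; 1ℚ; _/_; _+_; _-_; _*_; _≤_; _<_; toℚᵘ)
  import Data.Rational.Properties as ℚ
  import Data.Rational.Solver as ℚ-Solver
  open import Data.Rational.Unnormalised as ℚᵘ using (mkℚᵘ; *≡*; *<*; _≃_)
  import Data.Rational.Unnormalised.Properties as ℚᵘ
  open import Algebra.Bundles using (Ring)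
  open import Algebra.Properties.Semiring.Mult (Ring.semiring ℚ.+-*-ring) using (_×_; ×-assoc-*)
  open import Algebra.Properties.Semiring.Exp (Ring.semiring ℚ.+-*-ring) using (_^_)

  private
    toℚᵘ-/ : ∀ a d .{{_ : NonZero d}} → toℚᵘ (+ a / d) ≃ mkℚᵘ (+ a) (ℕ.pred d)
    toℚᵘ-/ a (suc d) = ℚ.toℚᵘ-fromℚᵘ (mkℚᵘ (+ a) d)

    mkℚᵘ-≃ : ∀ a b d e → a ℕ.* suc e ≡ b ℕ.* suc d → mkℚᵘ (+ a) d ≃ mkℚᵘ (+ b) e
    mkℚᵘ-≃ a b d e eq = *≡* (begin
      + a ℤ.* + suc e   ≡⟨ ℤ.pos-* a (suc e) ⟨
      + (a ℕ.* suc e)   ≡⟨ cong +_ eq ⟩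
      + (b ℕ.* suc d)   ≡⟨ ℤ.pos-* b (suc d) ⟩
      + b ℤ.* + suc d   ∎)
      where open ≡-Reasoning

  /-cong : ∀ a b d e .{{_ : NonZero d}} .{{_ : NonZero e}} →
           a ℕ.* e ≡ b ℕ.* d → + a / d ≡ + b / e
  /-cong a b (suc d) (suc e) eq = ℚ.fromℚᵘ-cong (mkℚᵘ-≃ a b d e eq)

  /-mono-< : ∀ a b d e .{{_ : NonZero d}} .{{_ : NonZero e}} →
             a ℕ.* e ℕ.< b ℕ.* d → + a / d < + b / e
  /-mono-< a b (suc d) (suc e) lt = ℚ.toℚᵘ-cancel-<
    (ℚᵘ.<-respʳ-≃ (ℚᵘ.≃-sym (toℚᵘ-/ b (suc e))) (ℚᵘ.<-respˡ-≃ (ℚᵘ.≃-sym (toℚᵘ-/ a (suc d)))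
      (*<* (subst₂ ℤ._<_ (ℤ.pos-* a (suc e)) (ℤ.pos-* b (suc d)) (ℤ.+<+ lt)))))

  /-nonNeg : ∀ a d .{{_ : NonZero d}} → 0ℚ ≤ + a / d
  /-nonNeg a d = ℚ.nonNegative⁻¹ (+ a / d) {{ℚ.normalize-nonNeg a d}}

  /-*-monoˡ-≤ : ∀ a d .{{_ : NonZero d}} {p q} → p ≤ q → (+ a / d) * p ≤ (+ a / d) * q
  /-*-monoˡ-≤ a d = ℚ.*-monoˡ-≤-nonNeg (+ a / d) {{ℚ.normalize-nonNeg a d}}

  /-* : ∀ a b d e .{{_ : NonZero d}} .{{_ : NonZero e}} .{{_ : NonZero (d ℕ.* e)}} →
        (+ a / d) * (+ b / e) ≡ + (a ℕ.* b) / (d ℕ.* e)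
  /-* a b (suc d) (suc e) = ℚ.toℚᵘ-injective (begin
    toℚᵘ ((+ a / suc d) * (+ b / suc e))             ≈⟨ ℚ.toℚᵘ-homo-* (+ a / suc d) (+ b / suc e) ⟩
    toℚᵘ (+ a / suc d) ℚᵘ.* toℚᵘ (+ b / suc e)       ≈⟨ ℚᵘ.*-cong (toℚᵘ-/ a (suc d)) (toℚᵘ-/ b (suc e)) ⟩
    mkℚᵘ (+ a ℤ.* + b) (ℕ.pred (suc d ℕ.* suc e))    ≡⟨ cong (λ i → mkℚᵘ i _) (ℤ.pos-* a b) ⟨
    mkℚᵘ (+ (a ℕ.* b)) (ℕ.pred (suc d ℕ.* suc e))    ≈⟨ ℚᵘ.≃-sym (toℚᵘ-/ (a ℕ.* b) (suc d ℕ.* suc e)) ⟩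
    toℚᵘ (+ (a ℕ.* b) / (suc d ℕ.* suc e))           ∎)
    where open ℚᵘ.≃-Reasoning

  /-+ : ∀ a b d .{{_ : NonZero d}} → + a / d + + b / d ≡ + (a ℕ.+ b) / d
  /-+ a b (suc d) = ℚ.toℚᵘ-injective (begin
    toℚᵘ (+ a / suc d + + b / suc d)                 ≈⟨ ℚ.toℚᵘ-homo-+ (+ a / suc d) (+ b / suc d) ⟩
    toℚᵘ (+ a / suc d) ℚᵘ.+ toℚᵘ (+ b / suc d)       ≈⟨ ℚᵘ.+-cong (toℚᵘ-/ a (suc d)) (toℚᵘ-/ b (suc d)) ⟩
    mkℚᵘ (+ a) d ℚᵘ.+ mkℚᵘ (+ b) d                   ≡⟨ cong (λ i → mkℚᵘ i _) numerator ⟩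
    mkℚᵘ (+ (a ℕ.* suc d ℕ.+ b ℕ.* suc d)) (ℕ.pred (suc d ℕ.* suc d))
      ≈⟨ mkℚᵘ-≃ _ _ _ _
           (solve 3 (λ a b d → (a :* d :+ b :* d) :* d := (a :+ b) :* (d :* d)) refl a b (suc d)) ⟩
    mkℚᵘ (+ (a ℕ.+ b)) d                             ≈⟨ ℚᵘ.≃-sym (toℚᵘ-/ (a ℕ.+ b) (suc d)) ⟩
    toℚᵘ (+ (a ℕ.+ b) / suc d)                       ∎)
    where
    open ℚᵘ.≃-Reasoning
    open +-*-Solver
    numerator : + a ℤ.* + suc d ℤ.+ + b ℤ.* + suc d ≡ + (a ℕ.* suc d ℕ.+ b ℕ.* suc d)
    numerator = trans (cong₂ ℤ._+_ (sym (ℤ.pos-* a (suc d))) (sym (ℤ.pos-* b (suc d))))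
                      (sym (ℤ.pos-+ (a ℕ.* suc d) (b ℕ.* suc d)))

  /-self : ∀ d .{{_ : NonZero d}} → + d / d ≡ 1ℚ
  /-self d = /-cong d 1 d 1 (ℕ.*-comm d 1)

  /-zero : ∀ d .{{_ : NonZero d}} → + 0 / d ≡ 0ℚ
  /-zero d = /-cong 0 0 d 1 refl

  1-/ : ∀ a b d .{{_ : NonZero d}} → a ℕ.+ b ≡ d → 1ℚ - + b / d ≡ + a / d
  1-/ a b d a+b≡d = begin
    1ℚ - + b / d                    ≡⟨ cong (_- + b / d) (trans (sym (/-self d)) (sym whole)) ⟩
    (+ a / d + + b / d) - + b / d   ≡⟨ solve 2 (λ x y → (x :+ y) :- y := x) refl (+ a / d) (+ b / d) ⟩
    + a / d                         ∎
    where
    open ≡-Reasoning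
    open ℚ-Solver.+-*-Solver
    whole : + a / d + + b / d ≡ + d / d
    whole = trans (/-+ a b d) (cong (λ n → + n / d) a+b≡d)

  ×-/ : ∀ k a d .{{_ : NonZero d}} → k × (+ a / d) ≡ + (k ℕ.* a) / d
  ×-/ zero    a d = sym (/-zero d)
  ×-/ (suc k) a d = trans (cong (λ z → + a / d + z) (×-/ k a d)) (/-+ a (k ℕ.* a) d)

  /-^ : ∀ a d k .{{_ : NonZero d}} → (+ a / d) ^ k ≡ (+ (a ℕ.^ k) / (d ℕ.^ k)) {{ℕ.m^n≢0 d k}}
  /-^ a d zero            = refl
  /-^ a d (suc k) {{d≢0}} = trans (cong ((+ a / d) *_) (/-^ a d k))
    (/-* a (a ℕ.^ k) d (d ℕ.^ k) {{d≢0}} {{ℕ.m^n≢0 d k}} {{ℕ.m^n≢0 d (suc k)}})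

  1-[x+c[1-x]] : ∀ x c → 1ℚ - (x + c * (1ℚ - x)) ≡ (1ℚ - c) * (1ℚ - x)
  1-[x+c[1-x]] =
    solve 2 (λ x c → con 1ℚ :- (x :+ c :* (con 1ℚ :- x)) := (con 1ℚ :- c) :* (con 1ℚ :- x)) refl
    where open ℚ-Solver.+-*-Solver

  *-nonNeg : ∀ {p q} → 0ℚ ≤ p → 0ℚ ≤ q → 0ℚ ≤ p * q
  *-nonNeg {p} {q} 0≤p 0≤q =
    ℚ.nonNegative⁻¹ (p * q) {{ℚ.nonNeg*nonNeg⇒nonNeg p {{ℚ.nonNegative 0≤p}} q {{ℚ.nonNegative 0≤q}}}}

  private
    p≤p+q : ∀ {p q} → 0ℚ ≤ q → p ≤ p + q
    p≤p+q {p} 0≤q = ℚ.≤-trans (ℚ.≤-reflexive (sym (ℚ.+-identityʳ p))) (ℚ.+-monoʳ-≤ p 0≤q)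

    ^-nonNeg : ∀ {x} k → 0ℚ ≤ x → 0ℚ ≤ x ^ k
    ^-nonNeg zero    _   = ℚ.nonNegative⁻¹ 1ℚ
    ^-nonNeg (suc k) 0≤x = *-nonNeg 0≤x (^-nonNeg k 0≤x)

    ×-nonNeg : ∀ {x} k → 0ℚ ≤ x → 0ℚ ≤ k × x
    ×-nonNeg zero    _   = ℚ.≤-refl
    ×-nonNeg (suc k) 0≤x = ℚ.+-mono-≤ 0≤x (×-nonNeg k 0≤x)

  bernoulli : ∀ p {x d} → 0ℚ ≤ x → 0ℚ ≤ d → x ^ p * (x + suc p × d) ≤ (x + d) ^ suc p
  bernoulli zero    {x} {d} _   _   = ℚ.≤-reflexive
    (solve 2 (λ x d → con 1ℚ :* (x :+ (d :+ con 0ℚ)) := (x :+ d) :* con 1ℚ) refl x d)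
    where open ℚ-Solver.+-*-Solver
  bernoulli (suc p) {x} {d} 0≤x 0≤d = begin
    x * X * (x + (d + N))              ≤⟨ p≤p+q (*-nonNeg (*-nonNeg (^-nonNeg p 0≤x) 0≤d) (×-nonNeg (suc p) 0≤d)) ⟩
    x * X * (x + (d + N)) + X * d * N  ≡⟨ solve 4 (λ x d X N → x :* X :* (x :+ (d :+ N)) :+ X :* d :* N
                                                             := (x :+ d) :* (X :* (x :+ N))) refl x d X N ⟩
    (x + d) * (X * (x + N))            ≤⟨ ℚ.*-monoˡ-≤-nonNeg (x + d) {{ℚ.nonNegative (ℚ.+-mono-≤ 0≤x 0≤d)}}
                                            (bernoulli p 0≤x 0≤d) ⟩
    (x + d) * (x + d) ^ suc p          ∎
    where
    open ℚ.≤-Reasoning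
    open ℚ-Solver.+-*-Solver
    X = x ^ p
    N = suc p × d

  mixture-≤ : ∀ p {a x c} → 0ℚ ≤ x → 0ℚ ≤ c * (1ℚ - x) → a ≡ suc p × c →
              a * x ^ p + (1ℚ - a) * x ^ suc p ≤ (x + c * (1ℚ - x)) ^ suc p
  mixture-≤ p {x = x} {c} 0≤x 0≤c[1-x] refl = begin
    a * X + (1ℚ - a) * (x * X)        ≡⟨ solve 3 (λ a x X → a :* X :+ (con 1ℚ :- a) :* (x :* X)
                                                            := X :* (x :+ a :* (con 1ℚ :- x))) refl a x X ⟩
    X * (x + a * (1ℚ - x))            ≡⟨ cong (λ z → X * (x + z)) (×-assoc-* (suc p) c (1ℚ - x)) ⟩
    X * (x + suc p × (c * (1ℚ - x)))  ≤⟨ bernoulli p 0≤x 0≤c[1-x] ⟩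
    (x + c * (1ℚ - x)) ^ suc p        ∎
    where
    open ℚ.≤-Reasoning
    open ℚ-Solver.+-*-Solver
    a = suc p × c
    X = x ^ p

module Urn where

  open import Data.Nat as ℕ using (ℕ; zero; suc; _∸_)
  import Data.Nat.Properties as ℕ
  open import Data.Nat.Solver using (module +-*-Solver)
  open import Data.Integer using (+_)
  open import Data.Rational as ℚ using (ℚ; 0ℚ; 1ℚ; _/_; _+_; _-_; _*_; _≤_)
  import Data.Rational.Properties as ℚ
  import Data.Rational.Solver as ℚ-Solver
  open import Algebra.Bundles using (Ring)
  open import Algebra.Properties.Semiring.Mult (Ring.semiring ℚ.+-*-ring) using (_×_)
  open import Algebra.Properties.Semiring.Exp (Ring.semiring ℚ.+-*-ring) using (_^_)
  open import Defs using (probTLess)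
  open Rational

  pairs : ℕ → ℕ
  pairs n = n ℕ.* ℕ.pred n

  pairs-mono-≤ : ∀ {m n} → m ℕ.≤ n → pairs m ℕ.≤ pairs n
  pairs-mono-≤ m≤n = ℕ.*-mono-≤ m≤n (ℕ.pred-mono-≤ m≤n)

  pairs≤square : ∀ n → pairs n ℕ.≤ n ℕ.* n
  pairs≤square n = ℕ.*-monoʳ-≤ n ℕ.pred[n]≤n

  m+[2+n]≡2+[m+n] : ∀ m n → m ℕ.+ (2 ℕ.+ n) ≡ 2 ℕ.+ (m ℕ.+ n)
  m+[2+n]≡2+[m+n] m n = trans (ℕ.+-suc m (suc n)) (cong suc (ℕ.+-suc m n))

  -- pairFactor r m is x_s of the proof idea, for s = m + r.
  pairFactor : ℕ → ℕ → ℚ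
  pairFactor r zero    = 0ℚ
  pairFactor r (suc m) = pairFactor r m + (+ 2 / suc (m ℕ.+ r)) * (1ℚ - pairFactor r m)

  -- From here on r = 2 + q, so that the denominators s(s−1) are visibly nonzero.
  1-pairFactor : ∀ q m → 1ℚ - pairFactor (2 ℕ.+ q) m ≡ + pairs (2 ℕ.+ q) / pairs (2 ℕ.+ (m ℕ.+ q))
  1-pairFactor q zero    = sym (/-self (pairs (2 ℕ.+ q)))
  1-pairFactor q (suc m) = begin
    1ℚ - (x + c * (1ℚ - x))                          ≡⟨ 1-[x+c[1-x]] x c ⟩
    (1ℚ - c) * (1ℚ - x)                              ≡⟨ cong₂ _*_ 1-c≡ (1-pairFactor q m) ⟩
    (+ suc t / (3 ℕ.+ t)) * (+ E / pairs (2 ℕ.+ t))  ≡⟨ /-* (suc t) E (3 ℕ.+ t) (pairs (2 ℕ.+ t)) ⟩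
    + (suc t ℕ.* E) / ((3 ℕ.+ t) ℕ.* pairs (2 ℕ.+ t))
      ≡⟨ /-cong (suc t ℕ.* E) E ((3 ℕ.+ t) ℕ.* pairs (2 ℕ.+ t)) (pairs (3 ℕ.+ t))
           (solve 2 (λ t E → (con 1 :+ t) :* E :* ((con 3 :+ t) :* (con 2 :+ t))
                             := E :* ((con 3 :+ t) :* ((con 2 :+ t) :* (con 1 :+ t)))) refl t E) ⟩
    + E / pairs (3 ℕ.+ t)                            ∎
    where
    open ≡-Reasoning
    open +-*-Solver
    t = m ℕ.+ q
    E = pairs (2 ℕ.+ q)
    x = pairFactor (2 ℕ.+ q) m
    d = suc (m ℕ.+ (2 ℕ.+ q))
    c = + 2 / d
    d≡3+t : d ≡ 3 ℕ.+ t
    d≡3+t = cong suc (m+[2+n]≡2+[m+n] m q)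
    1-c≡ : 1ℚ - c ≡ + suc t / (3 ℕ.+ t)
    1-c≡ = trans (1-/ (suc t) 2 d (trans (ℕ.+-comm (suc t) 2) (sym d≡3+t)))
                 (/-cong (suc t) (suc t) d (3 ℕ.+ t) (cong (suc t ℕ.*_) (sym d≡3+t)))

  1-pairFactor-nonNeg : ∀ q m → 0ℚ ≤ 1ℚ - pairFactor (2 ℕ.+ q) m
  1-pairFactor-nonNeg q m =
    subst (0ℚ ≤_) (sym (1-pairFactor q m)) (/-nonNeg (pairs (2 ℕ.+ q)) (pairs (2 ℕ.+ (m ℕ.+ q))))

  pairFactor-nonNeg : ∀ q m → 0ℚ ≤ pairFactor (2 ℕ.+ q) m
  pairFactor-nonNeg q zero    = ℚ.≤-refl
  pairFactor-nonNeg q (suc m) =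
    ℚ.+-mono-≤ (pairFactor-nonNeg q m) (*-nonNeg (/-nonNeg 2 (suc (m ℕ.+ (2 ℕ.+ q)))) (1-pairFactor-nonNeg q m))

  pairFactor≡Y/D : ∀ q m → let E = pairs (2 ℕ.+ q) ; D = pairs (2 ℕ.+ (m ℕ.+ q)) in
                   pairFactor (2 ℕ.+ q) m ≡ + (D ∸ E) / D
  pairFactor≡Y/D q m = begin
    x               ≡⟨ solve 1 (λ x → x := con 1ℚ :- (con 1ℚ :- x)) refl x ⟩
    1ℚ - (1ℚ - x)   ≡⟨ cong (1ℚ -_) (1-pairFactor q m) ⟩
    1ℚ - + E / D    ≡⟨ 1-/ (D ∸ E) E D (ℕ.m∸n+n≡m (pairs-mono-≤ (ℕ.s≤s (ℕ.s≤s (ℕ.m≤n+m q m))))) ⟩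
    + (D ∸ E) / D   ∎
    where
    open ≡-Reasoning
    open ℚ-Solver.+-*-Solver
    x = pairFactor (2 ℕ.+ q) m
    E = pairs (2 ℕ.+ q)
    D = pairs (2 ℕ.+ (m ℕ.+ q))

  -- probTLess w b (suc m) is Pr(T ≤ m); every round removes one ball, so s − m stays equal to r.
  probTLess-≤-pairFactor : ∀ q m p b → p ℕ.* 2 ℕ.+ b ≡ m ℕ.+ (2 ℕ.+ q) →
                           probTLess (p ℕ.* 2) b (suc m) ≤ pairFactor (2 ℕ.+ q) m ^ p
  probTLess-≤-pairFactor q m       zero    b _ = ℚ.≤-refl
  probTLess-≤-pairFactor q zero    (suc p) b _ = ℚ.≤-reflexive
    (solve 3 (λ w b y → w :* con 0ℚ :+ b :* con 0ℚ := con 0ℚ :* y) refl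
      (+ (suc p ℕ.* 2) / (suc p ℕ.* 2 ℕ.+ b)) (+ b / (suc p ℕ.* 2 ℕ.+ b)) (0ℚ ^ p))
    where open ℚ-Solver.+-*-Solver
  probTLess-≤-pairFactor q (suc m) (suc p) b s≡ = begin
    w * probTLess (p ℕ.* 2) (suc b) (suc m) + (+ b / s) * probTLess (suc p ℕ.* 2) (b ∸ 1) (suc m)
      ≤⟨ ℚ.+-mono-≤ (/-*-monoˡ-≤ (suc p ℕ.* 2) s whiteIH) (blackIH b s≡) ⟩
    w * x ^ p + (+ b / s) * x ^ suc p
      ≡⟨ cong (λ z → w * x ^ p + z * x ^ suc p) (sym (1-/ b (suc p ℕ.* 2) s (ℕ.+-comm b _))) ⟩
    w * x ^ p + (1ℚ - w) * x ^ suc p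
      ≤⟨ mixture-≤ p {c = + 2 / d} (pairFactor-nonNeg q m)
                   (*-nonNeg (/-nonNeg 2 d) (1-pairFactor-nonNeg q m)) w≡ ⟩
    pairFactor (2 ℕ.+ q) (suc m) ^ suc p
      ∎
    where
    open ℚ.≤-Reasoning
    x = pairFactor (2 ℕ.+ q) m
    s = suc p ℕ.* 2 ℕ.+ b
    w = + (suc p ℕ.* 2) / s
    d = suc (m ℕ.+ (2 ℕ.+ q))
    w≡ : w ≡ suc p × (+ 2 / d)
    w≡ = sym (trans (×-/ (suc p) 2 d)
                    (/-cong (suc p ℕ.* 2) (suc p ℕ.* 2) d s (cong (suc p ℕ.* 2 ℕ.*_) s≡)))
    whiteIH : probTLess (p ℕ.* 2) (suc b) (suc m) ≤ x ^ p
    whiteIH = probTLess-≤-pairFactor q m p (suc b) (trans (ℕ.+-suc (p ℕ.* 2) b) (ℕ.suc-injective s≡))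
    blackIH : ∀ b → suc p ℕ.* 2 ℕ.+ b ≡ suc m ℕ.+ (2 ℕ.+ q) →
              (+ b / (suc p ℕ.* 2 ℕ.+ b)) * probTLess (suc p ℕ.* 2) (b ∸ 1) (suc m)
                ≤ (+ b / (suc p ℕ.* 2 ℕ.+ b)) * x ^ suc p
    blackIH zero    _  = ℚ.≤-reflexive (trans (no-black _) (sym (no-black _)))
      where
      no-black : ∀ y → (+ 0 / (suc p ℕ.* 2 ℕ.+ 0)) * y ≡ 0ℚ
      no-black y = trans (cong (_* y) (/-zero (suc p ℕ.* 2 ℕ.+ 0))) (ℚ.*-zeroˡ y)
    blackIH (suc b) s≡ = /-*-monoˡ-≤ (suc b) (suc p ℕ.* 2 ℕ.+ suc b) (probTLess-≤-pairFactor q m (suc p) b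
      (trans (cong suc (sym (ℕ.+-suc (p ℕ.* 2) b))) (ℕ.suc-injective s≡)))
module Arithmetic where

  open import Data.Nat
  open import Data.Nat.Properties
  open import Data.Nat.Solver using (module +-*-Solver)
  open import Data.Product using (_,_)
  open import Data.Sum using (inj₁; inj₂)
  open +-*-Solver

  private
    *-positive : ∀ {a b} → 0 < a → 0 < b → 0 < a * b
    *-positive = *-mono-≤

    ^-positive : ∀ {a} k → 0 < a → 0 < a ^ k
    ^-positive {a} k 0<a = m^n>0 a {{>-nonZero 0<a}} k

    4xy≤[x+y]²-ordered : ∀ {x y} → x ≤ y → 4 * x * y ≤ (x + y) * (x + y)
    4xy≤[x+y]²-ordered {x} x≤y with m≤n⇒∃[o]m+o≡n x≤y
    ... | c , refl = ≤-trans (m≤m+n (4 * x * (x + c)) (c * c)) (≤-reflexive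
          (solve 2 (λ x c → con 4 :* x :* (x :+ c) :+ c :* c := (x :+ (x :+ c)) :* (x :+ (x :+ c))) refl x c))

  4xy≤[x+y]² : ∀ x y → 4 * x * y ≤ (x + y) * (x + y)
  4xy≤[x+y]² x y with ≤-total x y
  ... | inj₁ x≤y = 4xy≤[x+y]²-ordered x≤y
  ... | inj₂ y≤x = subst₂ _≤_ (solve 2 (λ x y → con 4 :* y :* x := con 4 :* x :* y) refl x y)
                              (solve 2 (λ x y → (y :+ x) :* (y :+ x) := (x :+ y) :* (x :+ y)) refl x y)
                              (4xy≤[x+y]²-ordered y≤x)

  bernoulli : ∀ j Y E → Y ^ j * (Y + suc j * E) ≤ (Y + E) ^ suc j
  bernoulli zero    Y E =
    ≤-reflexive (solve 2 (λ Y E → con 1 :* (Y :+ (E :+ con 0)) := (Y :+ E) :* con 1) refl Y E)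
  bernoulli (suc j) Y E = begin
    Y * X * (Y + (E + N))                ≤⟨ m≤m+n _ (X * E * N) ⟩
    Y * X * (Y + (E + N)) + X * E * N    ≡⟨ solve 4 (λ Y E X N → Y :* X :* (Y :+ (E :+ N)) :+ X :* E :* N
                                                        := (Y :+ E) :* (X :* (Y :+ N))) refl Y E X N ⟩
    (Y + E) * (X * (Y + N))              ≤⟨ *-monoʳ-≤ (Y + E) (bernoulli j Y E) ⟩
    (Y + E) * (Y + E) ^ suc j            ∎
    where
    open ≤-Reasoning
    X = Y ^ j
    N = suc j * E

  α⁴Y<n³[Y+kE] : ∀ n k α E Y → n ≡ k * 2 → 0 < n → 0 < α → α * α ≤ E → Y + E ≤ n * n →
                 α ^ 4 * Y < n ^ 3 * (Y + k * E)
  α⁴Y<n³[Y+kE] .(k * 2) k α E Y refl 0<n 0<α α²≤E Y+E≤n² = *-cancelˡ-< 4 _ _ (begin-strict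
    4 * (α ^ 4 * Y)            ≡⟨ solve 2 (λ α Y → con 4 :* (α :^ 4 :* Y) := (α :* α) :* (con 4 :* (α :* α) :* Y))
                                    refl α Y ⟩
    A * (4 * A * Y)            ≤⟨ *-monoʳ-≤ A (4xy≤[x+y]² A Y) ⟩
    A * ((A + Y) * (A + Y))    ≤⟨ *-monoʳ-≤ A (*-mono-≤ A+Y≤N A+Y≤N) ⟩
    A * (N * N)                <⟨ m<m+n (A * (N * N)) (*-positive (*-positive 0<α 0<α) (*-positive N>0 N>0)) ⟩
    A * (N * N) + A * (N * N)  ≤⟨ +-mono-≤ A·N²≤E·N² A·N²≤E·N² ⟩
    E * (N * N) + E * (N * N)  ≡⟨ solve 2 (λ k E → let n = k :* con 2 ; N = n :* n in
                                      E :* (N :* N) :+ E :* (N :* N) := con 4 :* (n :^ 3 :* (k :* E))) refl k E ⟩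
    4 * (n ^ 3 * (k * E))      ≤⟨ *-monoʳ-≤ 4 (*-monoʳ-≤ (n ^ 3) (m≤n+m (k * E) Y)) ⟩
    4 * (n ^ 3 * (Y + k * E))  ∎)
    where
    open ≤-Reasoning
    n = k * 2
    A = α * α
    N = n * n
    N>0 = *-positive 0<n 0<n
    A+Y≤N : A + Y ≤ N
    A+Y≤N = ≤-trans (≤-reflexive (+-comm A Y)) (≤-trans (+-monoʳ-≤ Y α²≤E) Y+E≤n²)
    A·N²≤E·N² : A * (N * N) ≤ E * (N * N)
    A·N²≤E·N² = *-monoˡ-≤ (N * N) α²≤E

  Y^kα⁴<n³D^k : ∀ n k α E Y D → n ≡ k * 2 → 0 < n → 0 < α → α * α ≤ E → Y + E ≡ D → D ≤ n * n →
                Y ^ k * α ^ 4 < n ^ 3 * D ^ k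
  Y^kα⁴<n³D^k n zero    α E Y       D refl () _ _ _ _
  Y^kα⁴<n³D^k n (suc j) α E zero    D _  0<n 0<α α²≤E refl _ =
    *-positive (^-positive 3 0<n) (^-positive (suc j) (≤-trans (*-positive 0<α 0<α) α²≤E))
  Y^kα⁴<n³D^k n (suc j) α E (suc y) D n≡ 0<n 0<α α²≤E refl D≤n² = begin-strict
    Y ^ suc j * α ^ 4              ≡⟨ solve 3 (λ Y X A → (Y :* X) :* A := X :* (A :* Y)) refl Y X (α ^ 4) ⟩
    X * (α ^ 4 * Y)                <⟨ *-monoʳ-< X {{m^n≢0 Y j}}
                                        (α⁴Y<n³[Y+kE] n (suc j) α E Y n≡ 0<n 0<α α²≤E D≤n²) ⟩
    X * (n ^ 3 * (Y + suc j * E))  ≡⟨ solve 3 (λ X M Z → X :* (M :* Z) := M :* (X :* Z)) refl X (n ^ 3) _ ⟩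
    n ^ 3 * (X * (Y + suc j * E))  ≤⟨ *-monoʳ-≤ (n ^ 3) (bernoulli j Y E) ⟩
    n ^ 3 * (Y + E) ^ suc j        ∎
    where
    open ≤-Reasoning
    Y = suc y
    X = Y ^ j

open import Defs
open import Data.Nat as ℕ using (ℕ; suc; _∸_; _+_; _*_; _^_; _<_; s≤s; z≤n)
import Data.Nat.Properties as ℕ
open import Data.Nat.Divisibility using (_∣_; divides)
open import Data.Integer using (+_)
open import Data.Rational using (_/_) renaming (_<_ to _<ℚ_)
import Data.Rational.Properties as ℚ
open import Algebra.Bundles using (Ring)
open import Algebra.Properties.Semiring.Exp (Ring.semiring ℚ.+-*-ring) using () renaming (_^_ to _^ℚ_)
open Rational using (/-^; /-mono-<)
open Urn
open Arithmetic using (Y^kα⁴<n³D^k)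

probTLess<n³/α⁴ : ∀ q m k → m + (2 + q) ≡ k * 2 →
                  probTLess (k * 2) 0 (suc m) <ℚ + ((k * 2) ^ 3) / (suc q ^ 4)
probTLess<n³/α⁴ q m k s≡n = begin-strict
  probTLess n 0 (suc m)      ≤⟨ probTLess-≤-pairFactor q m k 0 (trans (ℕ.+-identityʳ n) (sym s≡n)) ⟩
  pairFactor (2 + q) m ^ℚ k  ≡⟨ cong (_^ℚ k) (pairFactor≡Y/D q m) ⟩
  (+ Y / D) ^ℚ k             ≡⟨ /-^ Y D k ⟩
  + (Y ^ k) / (D ^ k)        <⟨ /-mono-< (Y ^ k) (n ^ 3) (D ^ k) (α ^ 4)
                                  (Y^kα⁴<n³D^k n k α E Y D refl 0<n (s≤s z≤n) α²≤E (ℕ.m∸n+n≡m E≤D) D≤n²) ⟩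
  + (n ^ 3) / (α ^ 4)        ∎
  where
  open ℚ.≤-Reasoning
  n = k * 2
  α = suc q
  E = pairs (2 + q)
  D = pairs (2 + (m + q))
  Y = D ∸ E
  instance
    D^k≢0 : ℕ.NonZero (D ^ k)
    D^k≢0 = ℕ.m^n≢0 D k
  0<n : 0 < n
  0<n = subst (0 <_) s≡n (ℕ.≤-trans (s≤s z≤n) (ℕ.m≤n+m (2 + q) m))
  α²≤E : α * α ℕ.≤ E
  α²≤E = ℕ.*-monoˡ-≤ α (ℕ.n≤1+n α)
  E≤D : E ℕ.≤ D
  E≤D = pairs-mono-≤ (s≤s (s≤s (ℕ.m≤n+m q m)))
  D≤n² : D ℕ.≤ n * n
  D≤n² = subst (λ s → D ℕ.≤ s * s) (trans (sym (m+[2+n]≡2+[m+n] m q)) s≡n) (pairs≤square (2 + (m + q)))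

proposition4p2 : (n α : ℕ) → 2 ∣ n → (α>0 : 0 < α) → α < n →
    probTLess n 0 (n ∸ α) <ℚ bound n α α>0
proposition4p2 .(k * 2) α@(suc q) (divides k refl) α>0 α<n =
  subst (λ t → probTLess (k * 2) 0 t <ℚ bound (k * 2) α α>0) (sym n∸α≡1+m)
        (probTLess<n³/α⁴ q m k m+r≡n)
  where
  m = k * 2 ∸ suc α
  m+r≡n : m + suc α ≡ k * 2
  m+r≡n = ℕ.m∸n+n≡m α<n
  n∸α≡1+m : k * 2 ∸ α ≡ suc m
  n∸α≡1+m = trans (cong (_∸ α) (trans (sym m+r≡n) (ℕ.+-suc m α))) (ℕ.m+n∸n≡m (suc m) α)
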